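{- Every function $\mathbb{Z}\to\mathbb{Z}$ in $\{\max,\mathsf{div}_m\mid m\in\mathbb{Z}\setminus\{0\}\}^\circ$ is pseudo-linear.
   Context: $\mathsf{div}_m(x)=\lfloor x/m\rfloor$. For a set $F$ of functions, $F^\circ$ is the set of all functions computed by circuits whose gates compute either affine functions with integer coefficients of their inputs or functions from $F$. A function $g\colon\mathbb{Z}\to\mathbb{Q}$ is linear if $g(x)=ax+b$ for some $a,b\in\mathbb{Q}$. A function $f\colon\mathbb{Z}\to\mathbb{Q}$ is pseudo-linear if there are constants $M,B\ge 0$ and linear functions $g,h\colon\mathbb{Z}\to\mathbb{Q}$ such that $|f(x)-g(x)|\le B$ for all $x\le -M$ and $|f(x)-h(x)|\le B$ for all $x\ge M$. -}

module Defs where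

open import Data.Nat using (ℕ; zero; suc)
open import Data.Fin using (Fin; zero; suc)
open import Data.Integer as ℤ using (ℤ; +_; -[1+_]; _⊔_)
open import Data.Rational as ℚ using (ℚ; floor; ∣_∣; _≤_; 0ℚ)
open import Data.Product using (Σ; _×_; _,_)
open import Relation.Binary.PropositionalEquality using (_≢_)

toℚ : ℤ → ℚ
toℚ x = x ℚ./ 1

-- div_m(x) = ⌊x/m⌋ (floor of the rational quotient), for m ≠ 0.
-- For m = 0 an arbitrary value is returned; circuits only use m ≠ 0.
divFloor : ℤ → ℤ → ℤ
divFloor (+ zero)    x = + 0
divFloor (+ (suc n)) x = floor (x ℚ./ suc n)
divFloor -[1+ n ]    x = floor ((ℤ.- x) ℚ./ suc n)   -- x/(-(n+1)) = (-x)/(n+1)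

sumℤ : (n : ℕ) → (Fin n → ℤ) → ℤ
sumℤ zero    f = + 0
sumℤ (suc n) f = f zero ℤ.+ sumℤ n (λ i → f (suc i))

-- Circuits (as formulas/terms) with a single input variable, whose gates are
-- affine maps with integer coefficients (of any arity), binary max, or div_m, m ≠ 0.
data Circuit : Set where
  input : Circuit
  affine : (n : ℕ) → (c : ℤ) → (a : Fin n → ℤ) → (Fin n → Circuit) → Circuit
  maxG  : Circuit → Circuit → Circuit
  divG  : (m : ℤ) → m ≢ + 0 → Circuit → Circuit

eval : Circuit → ℤ → ℤ
eval input x = x
eval (affine n c a es) x = c ℤ.+ sumℤ n (λ i → a i ℤ.* eval (es i) x)
eval (maxG e₁ e₂) x = eval e₁ x ⊔ eval e₂ x
eval (divG m _ e) x = divFloor m (eval e x)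

InMaxDivClosure : (ℤ → ℤ) → Set
InMaxDivClosure f = Σ Circuit λ C → ∀ x → eval C x ≡ f x
  where open import Relation.Binary.PropositionalEquality using (_≡_)

linear : ℚ → ℚ → ℤ → ℚ
linear a b x = a ℚ.* toℚ x ℚ.+ b

PseudoLinear : (ℤ → ℚ) → Set
PseudoLinear f =
  Σ ℚ λ M → Σ ℚ λ B → (0ℚ ≤ M) × (0ℚ ≤ B) ×
  Σ ℚ λ a₁ → Σ ℚ λ b₁ → Σ ℚ λ a₂ → Σ ℚ λ b₂ →
    (∀ x → toℚ x ≤ ℚ.- M → ∣ f x ℚ.- linear a₁ b₁ x ∣ ≤ B) ×
    (∀ x → M ≤ toℚ x → ∣ f x ℚ.- linear a₂ b₂ x ∣ ≤ B)

{-# OPTIONS --safe #-}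
module Submission where

open import Data.Fin using (Fin; zero; suc)
open import Data.Integer.Base as ℤ using (ℤ; +_; -[1+_]; _+_; _*_; _-_; -_; _⊔_; _≤_; +≤+; ∣_∣)
import Data.Integer.DivMod as ℤ
open import Data.Integer.GCD using (gcd)
import Data.Integer.Properties as ℤ
open import Data.Integer.Tactic.RingSolver using (solve-∀; solve)
open import Data.List using (_∷_; [])
open import Data.Nat.Base as ℕ using (ℕ; zero; suc)
import Data.Nat.Properties as ℕ
open import Data.Product using (_,_)
open import Data.Rational.Base as ℚ using (ℚ; mkℚ; floor; ↥_; ↧_; ↧ₙ_; 0ℚ; 1ℚ)
import Data.Rational.Properties as ℚ
open import Data.Rational.Solver using (module +-*-Solver)
open import Data.Rational.Unnormalised.Base as ℚᵘ using (mkℚᵘ; *≡*; *≤*)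
import Data.Rational.Unnormalised.Properties as ℚᵘ
open import Data.Sum using (inj₁; inj₂)
open import Relation.Binary.PropositionalEquality
import Relation.Binary.Reasoning.Setoid as ≈-Reasoning
open import Relation.Nullary using (contradiction)

open import Defs

-- Call f eventually linear if there are integers P, D > 0 and B with ∣D·f(x) − P·x∣ ≤ B for all
-- large x, i.e. f stays within B/D of the line of slope P/D. Constants and the identity are
-- eventually linear, and the class is closed under integer affine combinations (over a common
-- denominator), under max (for D, x ≥ 0 scaling by D or x commutes with max, and max is
-- 1-Lipschitz in the sup norm) and under div_m (since ⌊y/m⌋·m is within m of y). Hence every
-- circuit, fed with x or with −x, is eventually linear, which yields the two tails of
-- pseudo-linearity; keeping slopes as integer fractions P/D, all of this happens in ℤ.

∣j∣≤n⇒∣i*j∣≤∣i∣*n : ∀ i {j n} → ∣ j ∣ ℕ.≤ n → ∣ i * j ∣ ℕ.≤ ∣ i ∣ ℕ.* n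
∣j∣≤n⇒∣i*j∣≤∣i∣*n i {j} ∣j∣≤n =
  ℕ.≤-trans (ℕ.≤-reflexive (ℤ.∣i*j∣≡∣i∣*∣j∣ i j)) (ℕ.*-monoʳ-≤ ∣ i ∣ ∣j∣≤n)

i≤∣i∣ : ∀ i → i ≤ + ∣ i ∣
i≤∣i∣ (+ n)    = ℤ.≤-refl
i≤∣i∣ -[1+ n ] = ℤ.-≤+

i≤j+∣i-j∣ : ∀ i j → i ≤ j + + ∣ i - j ∣
i≤j+∣i-j∣ i j = begin
  i                ≡⟨ solve (i ∷ j ∷ []) ⟩
  j + (i - j)      ≤⟨ ℤ.+-monoʳ-≤ j (i≤∣i∣ (i - j)) ⟩
  j + + ∣ i - j ∣  ∎
  where open ℤ.≤-Reasoning

i≤j+k⇒i-j≤k : ∀ {i j k} → i ≤ j + k → i - j ≤ k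
i≤j+k⇒i-j≤k {i} {j} {k} i≤j+k = begin
  i - j      ≤⟨ ℤ.+-monoˡ-≤ (- j) i≤j+k ⟩
  j + k - j  ≡⟨ solve (j ∷ k ∷ []) ⟩
  k          ∎
  where open ℤ.≤-Reasoning

i≤j+n⇒j≤i+n⇒∣i-j∣≤n : ∀ {i j n} → i ≤ j + + n → j ≤ i + + n → ∣ i - j ∣ ℕ.≤ n
i≤j+n⇒j≤i+n⇒∣i-j∣≤n {i} {j} i≤j+n j≤i+n with ℤ.≤-total i j
... | inj₁ i≤j = ℤ.drop‿+≤+ (subst (_≤ _) (sym (ℤ.∣-∣-≤ i≤j)) (i≤j+k⇒i-j≤k j≤i+n))
... | inj₂ j≤i = ℤ.drop‿+≤+ (subst (_≤ _) (sym ∣i-j∣≡i-j) (i≤j+k⇒i-j≤k i≤j+n))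
  where
  ∣i-j∣≡i-j : + ∣ i - j ∣ ≡ i - j
  ∣i-j∣≡i-j = trans (cong +_ (ℤ.∣i-j∣≡∣j-i∣ i j)) (ℤ.∣-∣-≤ j≤i)

⊔-mono-≤-+ : ∀ {i j} k l {m n} → i ≤ k + + m → j ≤ l + + n → i ⊔ j ≤ (k ⊔ l) + + (m ℕ.⊔ n)
⊔-mono-≤-+ k l {m} {n} i≤k+m j≤l+n = ℤ.⊔-lub
  (ℤ.≤-trans i≤k+m (ℤ.+-mono-≤ (ℤ.i≤i⊔j k l) (+≤+ (ℕ.m≤m⊔n m n))))
  (ℤ.≤-trans j≤l+n (ℤ.+-mono-≤ (ℤ.i≤j⊔i k l) (+≤+ (ℕ.m≤n⊔m m n))))

∣i⊔j-k⊔l∣≤∣i-k∣⊔∣j-l∣ : ∀ i j k l → ∣ (i ⊔ j) - (k ⊔ l) ∣ ℕ.≤ ∣ i - k ∣ ℕ.⊔ ∣ j - l ∣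
∣i⊔j-k⊔l∣≤∣i-k∣⊔∣j-l∣ i j k l = i≤j+n⇒j≤i+n⇒∣i-j∣≤n
  (⊔-mono-≤-+ k l (i≤j+∣i-j∣ i k) (i≤j+∣i-j∣ j l))
  (⊔-mono-≤-+ i j (i≤j+∣j-i∣ k i) (i≤j+∣j-i∣ l j))
  where
  i≤j+∣j-i∣ : ∀ i j → i ≤ j + + ∣ j - i ∣
  i≤j+∣j-i∣ i j = subst (λ n → i ≤ j + + n) (ℤ.∣i-j∣≡∣j-i∣ i j) (i≤j+∣i-j∣ i j)

floor≡↥/↧ : ∀ p → floor p ≡ ↥ p ℤ./ ↧ p
floor≡↥/↧ (mkℚ _ _ _) = refl

-- i / n is stored in lowest terms ↥ p / ↧ p, with i = ↥ p · g and n = ↧ p · g for g = gcd i n,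
-- so i − ⌊i/n⌋ · n = (↥ p mod ↧ p) · g.
∣i-⌊i/n⌋*n∣≤n : ∀ i n .{{_ : ℕ.NonZero n}} → ∣ i - floor (i ℚ./ n) * + n ∣ ℕ.≤ n
∣i-⌊i/n⌋*n∣≤n i n = let open ℕ.≤-Reasoning in begin
  ∣ i - floor p * + n ∣  ≡⟨ cong ∣_∣ i-⌊p⌋*n≡r*g ⟩
  ∣ + r * g ∣            ≡⟨ ℤ.∣i*j∣≡∣i∣*∣j∣ (+ r) g ⟩
  r ℕ.* ∣ g ∣            ≤⟨ ℕ.*-monoˡ-≤ ∣ g ∣ (ℕ.<⇒≤ (ℤ.n%d<d (↥ p) (↧ p))) ⟩
  ↧ₙ p ℕ.* ∣ g ∣         ≡⟨ ℤ.∣i*j∣≡∣i∣*∣j∣ (↧ p) g ⟨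
  ∣ ↧ p * g ∣            ≡⟨ cong ∣_∣ (ℚ.↧-/ i n) ⟩
  n                      ∎
  where
  p = i ℚ./ n
  g = gcd i (+ n)
  r = ↥ p ℤ.% ↧ p
  q = ↥ p ℤ./ ↧ p
  cancel : ∀ r q d g → (r + q * d) * g - q * (d * g) ≡ r * g
  cancel = solve-∀
  i-⌊p⌋*n≡r*g : i - floor p * + n ≡ + r * g
  i-⌊p⌋*n≡r*g = begin
    i - floor p * + n                    ≡⟨ cong₂ (λ a b → a - floor p * b) (ℚ.↥-/ i n) (ℚ.↧-/ i n) ⟨
    ↥ p * g - floor p * (↧ p * g)        ≡⟨ cong₂ (λ a c → a * g - c * (↧ p * g))
                                                  (ℤ.a≡a%n+[a/n]*n (↥ p) (↧ p)) (floor≡↥/↧ p) ⟩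
    (+ r + q * ↧ p) * g - q * (↧ p * g)  ≡⟨ cancel (+ r) q (↧ p) g ⟩
    + r * g                              ∎
    where open ≡-Reasoning

toℚᵘ-toℚ : ∀ i → ℚ.toℚᵘ (toℚ i) ℚᵘ.≃ mkℚᵘ i 0
toℚᵘ-toℚ i = ℚ.toℚᵘ-fromℚᵘ (mkℚᵘ i 0)

toℚ-homo‿- : ∀ i → toℚ (- i) ≡ ℚ.- toℚ i
toℚ-homo‿- i = ℚ.toℚᵘ-injective (begin
  ℚ.toℚᵘ (toℚ (- i))   ≈⟨ toℚᵘ-toℚ (- i) ⟩
  mkℚᵘ (- i) 0         ≈⟨ ℚᵘ.-‿cong (toℚᵘ-toℚ i) ⟨
  ℚᵘ.- ℚ.toℚᵘ (toℚ i)  ≈⟨ ℚ.toℚᵘ-homo‿- (toℚ i) ⟨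
  ℚ.toℚᵘ (ℚ.- toℚ i)   ∎)
  where open ≈-Reasoning ℚᵘ.≃-setoid

toℚ-homo-minus : ∀ i j → toℚ (i - j) ≡ toℚ i ℚ.- toℚ j
toℚ-homo-minus i j = ℚ.toℚᵘ-injective (begin
  ℚ.toℚᵘ (toℚ (i - j))                    ≈⟨ toℚᵘ-toℚ (i - j) ⟩
  mkℚᵘ (i - j) 0                          ≈⟨ *≡* (unit-denominators i j) ⟩
  mkℚᵘ i 0 ℚᵘ.- mkℚᵘ j 0                  ≈⟨ ℚᵘ.+-cong (toℚᵘ-toℚ i) (ℚᵘ.-‿cong (toℚᵘ-toℚ j)) ⟨
  ℚ.toℚᵘ (toℚ i) ℚᵘ.- ℚ.toℚᵘ (toℚ j)      ≈⟨ ℚᵘ.+-congʳ (ℚ.toℚᵘ (toℚ i)) (ℚ.toℚᵘ-homo‿- (toℚ j)) ⟨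
  ℚ.toℚᵘ (toℚ i) ℚᵘ.+ ℚ.toℚᵘ (ℚ.- toℚ j)  ≈⟨ ℚ.toℚᵘ-homo-+ (toℚ i) (ℚ.- toℚ j) ⟨
  ℚ.toℚᵘ (toℚ i ℚ.- toℚ j)                ∎)
  where
  open ≈-Reasoning ℚᵘ.≃-setoid
  unit-denominators : ∀ i j → (i - j) * + 1 ≡ (i * + 1 + - j * + 1) * + 1
  unit-denominators = solve-∀

toℚ-homo-* : ∀ i j → toℚ (i * j) ≡ toℚ i ℚ.* toℚ j
toℚ-homo-* i j = ℚ.toℚᵘ-injective (begin
  ℚ.toℚᵘ (toℚ (i * j))                ≈⟨ toℚᵘ-toℚ (i * j) ⟩
  mkℚᵘ i 0 ℚᵘ.* mkℚᵘ j 0              ≈⟨ ℚᵘ.*-cong (toℚᵘ-toℚ i) (toℚᵘ-toℚ j) ⟨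
  ℚ.toℚᵘ (toℚ i) ℚᵘ.* ℚ.toℚᵘ (toℚ j)  ≈⟨ ℚ.toℚᵘ-homo-* (toℚ i) (toℚ j) ⟨
  ℚ.toℚᵘ (toℚ i ℚ.* toℚ j)            ∎)
  where open ≈-Reasoning ℚᵘ.≃-setoid

toℚ-homo-∣-∣ : ∀ i → toℚ (+ ∣ i ∣) ≡ ℚ.∣ toℚ i ∣
toℚ-homo-∣-∣ i = ℚ.toℚᵘ-injective (begin
  ℚ.toℚᵘ (toℚ (+ ∣ i ∣))  ≈⟨ toℚᵘ-toℚ (+ ∣ i ∣) ⟩
  ℚᵘ.∣ mkℚᵘ i 0 ∣         ≈⟨ ℚᵘ.∣-∣-cong (toℚᵘ-toℚ i) ⟨
  ℚᵘ.∣ ℚ.toℚᵘ (toℚ i) ∣   ≈⟨ ℚ.toℚᵘ-homo-∣-∣ (toℚ i) ⟨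
  ℚ.toℚᵘ ℚ.∣ toℚ i ∣      ∎)
  where open ≈-Reasoning ℚᵘ.≃-setoid

toℚ-mono-≤ : ∀ {i j} → i ≤ j → toℚ i ℚ.≤ toℚ j
toℚ-mono-≤ {i} {j} i≤j = ℚ.toℚᵘ-cancel-≤
  (ℚᵘ.≤-respˡ-≃ (ℚᵘ.≃-sym (toℚᵘ-toℚ i)) (ℚᵘ.≤-respʳ-≃ (ℚᵘ.≃-sym (toℚᵘ-toℚ j))
    (*≤* (ℤ.*-monoʳ-≤-nonNeg (+ 1) i≤j))))

toℚ-cancel-≤ : ∀ {i j} → toℚ i ℚ.≤ toℚ j → i ≤ j
toℚ-cancel-≤ {i} {j} i≤j = ℤ.*-cancelʳ-≤-pos i j (+ 1)
  (ℚᵘ.drop-*≤* (ℚᵘ.≤-respˡ-≃ (toℚᵘ-toℚ i) (ℚᵘ.≤-respʳ-≃ (toℚᵘ-toℚ j) (ℚ.toℚᵘ-mono-≤ i≤j))))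

n*[i/n]≡i : ∀ i d → toℚ (+ suc d) ℚ.* (i ℚ./ suc d) ≡ toℚ i
n*[i/n]≡i i d = ℚ.toℚᵘ-injective (begin
  ℚ.toℚᵘ (toℚ (+ suc d) ℚ.* (i ℚ./ suc d))          ≈⟨ ℚ.toℚᵘ-homo-* (toℚ (+ suc d)) (i ℚ./ suc d) ⟩
  ℚ.toℚᵘ (toℚ (+ suc d)) ℚᵘ.* ℚ.toℚᵘ (i ℚ./ suc d)  ≈⟨ ℚᵘ.*-cong (toℚᵘ-toℚ (+ suc d))
                                                                   (ℚ.toℚᵘ-fromℚᵘ (mkℚᵘ i d)) ⟩
  mkℚᵘ (+ suc d) 0 ℚᵘ.* mkℚᵘ i d                    ≈⟨ *≡* cancel ⟩
  mkℚᵘ i 0                                          ≈⟨ toℚᵘ-toℚ i ⟨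
  ℚ.toℚᵘ (toℚ i)                                    ∎)
  where
  open ≈-Reasoning ℚᵘ.≃-setoid
  commute : ∀ k i → k * i * + 1 ≡ i * k
  commute = solve-∀
  cancel : + suc d * i * + 1 ≡ i * + suc (d ℕ.+ 0)
  cancel = trans (commute (+ suc d) i) (cong (λ n → i * + suc n) (sym (ℕ.+-identityʳ d)))

record Near (D y P x : ℤ) (B : ℕ) : Set where
  constructor near
  field
    ∣D*y-P*x∣≤B : ∣ D * y - P * x ∣ ℕ.≤ B

near-exact : ∀ {D y P x} e → D * y - P * x ≡ e → Near D y P x ∣ e ∣
near-exact e eq = near (ℕ.≤-reflexive (cong ∣_∣ eq))

near-rescale : ∀ k {D y P x B D′ y′ P′} → Near D y P x B → k * (D * y - P * x) ≡ D′ * y′ - P′ * x →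
               Near D′ y′ P′ x (∣ k ∣ ℕ.* B)
near-rescale k (near dist≤B) eq = near (subst (λ z → ∣ z ∣ ℕ.≤ _) eq (∣j∣≤n⇒∣i*j∣≤∣i∣*n k dist≤B))

near-* : ∀ a {D y P x B} → Near D y P x B → Near D (a * y) (a * P) x (∣ a ∣ ℕ.* B)
near-* a {D} {y} {P} {x} n = near-rescale a n (solve (a ∷ D ∷ y ∷ P ∷ x ∷ []))

near-scaleˡ : ∀ k {D y P x B} → Near D y P x B → Near (k * D) y (k * P) x (∣ k ∣ ℕ.* B)
near-scaleˡ k {D} {y} {P} {x} n = near-rescale k n (solve (k ∷ D ∷ y ∷ P ∷ x ∷ []))

near-scaleʳ : ∀ k {D y P x B} → Near D y P x B → Near (D * k) y (k * P) x (∣ k ∣ ℕ.* B)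
near-scaleʳ k {D} {y} {P} {x} n = near-rescale k n (solve (k ∷ D ∷ y ∷ P ∷ x ∷ []))

near-flip : ∀ {D y P x B} → Near D y P (- x) B → Near D y (- P) x B
near-flip {D} {y} {P} {x} {B} (near dist≤B) = near (subst (λ t → ∣ D * y - t ∣ ℕ.≤ B) (flip P x) dist≤B)
  where
  flip : ∀ P x → P * - x ≡ - P * x
  flip = solve-∀

near-+ : ∀ {D y y′ P Q x B C} → Near D y P x B → Near D y′ Q x C → Near D (y + y′) (P + Q) x (B ℕ.+ C)
near-+ {D} {y} {y′} {P} {Q} {x} (near dist≤B) (near dist′≤C) = near (begin
  ∣ D * (y + y′) - (P + Q) * x ∣            ≡⟨ cong ∣_∣ split ⟩
  ∣ (D * y - P * x) + (D * y′ - Q * x) ∣    ≤⟨ ℤ.∣i+j∣≤∣i∣+∣j∣ (D * y - P * x) (D * y′ - Q * x) ⟩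
  ∣ D * y - P * x ∣ ℕ.+ ∣ D * y′ - Q * x ∣  ≤⟨ ℕ.+-mono-≤ dist≤B dist′≤C ⟩
  _                                         ∎)
  where
  open ℕ.≤-Reasoning
  split : D * (y + y′) - (P + Q) * x ≡ (D * y - P * x) + (D * y′ - Q * x)
  split = solve (D ∷ y ∷ y′ ∷ P ∷ Q ∷ x ∷ [])

near-⊔ : ∀ {k y y′ P Q n B C} → Near (+ k) y P (+ n) B → Near (+ k) y′ Q (+ n) C →
         Near (+ k) (y ⊔ y′) (P ⊔ Q) (+ n) (B ℕ.⊔ C)
near-⊔ {k} {y} {y′} {P} {Q} {n} (near dist≤B) (near dist′≤C) = near (begin
  ∣ + k * (y ⊔ y′) - (P ⊔ Q) * + n ∣                ≡⟨ cong₂ (λ u v → ∣ u - v ∣)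
                                                        (ℤ.*-distribˡ-⊔-nonNeg (+ k) y y′)
                                                        (ℤ.*-distribʳ-⊔-nonNeg (+ n) P Q) ⟩
  ∣ (+ k * y ⊔ + k * y′) - (P * + n ⊔ Q * + n) ∣    ≤⟨ ∣i⊔j-k⊔l∣≤∣i-k∣⊔∣j-l∣ (+ k * y) (+ k * y′)
                                                                              (P * + n) (Q * + n) ⟩
  ∣ + k * y - P * + n ∣ ℕ.⊔ ∣ + k * y′ - Q * + n ∣  ≤⟨ ℕ.⊔-mono-≤ dist≤B dist′≤C ⟩
  _                                                 ∎)
  where open ℕ.≤-Reasoning

near-quotient : ∀ {D y P x B q m c} → Near D y P x B → ∣ y - q * m ∣ ℕ.≤ c →
                Near (D * m) q P x (B ℕ.+ ∣ D ∣ ℕ.* c)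
near-quotient {D} {y} {P} {x} {B} {q} {m} (near dist≤B) ∣y-q*m∣≤c = near (begin
  ∣ D * m * q - P * x ∣                      ≡⟨ cong ∣_∣ split ⟩
  ∣ (D * y - P * x) - D * (y - q * m) ∣      ≤⟨ ℤ.∣i-j∣≤∣i∣+∣j∣ (D * y - P * x) (D * (y - q * m)) ⟩
  ∣ D * y - P * x ∣ ℕ.+ ∣ D * (y - q * m) ∣  ≤⟨ ℕ.+-mono-≤ dist≤B (∣j∣≤n⇒∣i*j∣≤∣i∣*n D ∣y-q*m∣≤c) ⟩
  _                                          ∎)
  where
  open ℕ.≤-Reasoning
  split : D * m * q - P * x ≡ (D * y - P * x) - D * (y - q * m)
  split = solve (D ∷ y ∷ P ∷ x ∷ q ∷ m ∷ [])

[y-Px/D]*D≡Dy-Px : ∀ d y P x →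
  (toℚ y ℚ.- linear (P ℚ./ suc d) 0ℚ x) ℚ.* toℚ (+ suc d) ≡ toℚ (+ suc d * y - P * x)
[y-Px/D]*D≡Dy-Px d y P x = begin
  (toℚ y ℚ.- linear (P ℚ./ suc d) 0ℚ x) ℚ.* D     ≡⟨ expand (toℚ y) (P ℚ./ suc d) (toℚ x) D ⟩
  D ℚ.* toℚ y ℚ.- D ℚ.* (P ℚ./ suc d) ℚ.* toℚ x  ≡⟨ cong (λ a → D ℚ.* toℚ y ℚ.- a ℚ.* toℚ x) (n*[i/n]≡i P d) ⟩
  D ℚ.* toℚ y ℚ.- toℚ P ℚ.* toℚ x                ≡⟨ cong₂ ℚ._-_ (toℚ-homo-* (+ suc d) y) (toℚ-homo-* P x) ⟨
  toℚ (+ suc d * y) ℚ.- toℚ (P * x)              ≡⟨ toℚ-homo-minus (+ suc d * y) (P * x) ⟨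
  toℚ (+ suc d * y - P * x)                      ∎
  where
  open ≡-Reasoning
  D = toℚ (+ suc d)
  expand : ∀ y a x D → (y ℚ.- (a ℚ.* x ℚ.+ 0ℚ)) ℚ.* D ≡ D ℚ.* y ℚ.- D ℚ.* a ℚ.* x
  expand = +-*-Solver.solve 4 (λ y a x D → (y :- (a :* x :+ con 0ℚ)) :* D := D :* y :- D :* a :* x) refl
    where open +-*-Solver

near⇒∣y-Px/D∣≤B : ∀ {d y P x B} → Near (+ suc d) y P x B →
                  ℚ.∣ toℚ y ℚ.- linear (P ℚ./ suc d) 0ℚ x ∣ ℚ.≤ toℚ (+ B)
near⇒∣y-Px/D∣≤B {d} {y} {P} {x} {B} (near dist≤B) = begin
  ℚ.∣ e ∣               ≡⟨ ℚ.*-identityʳ ℚ.∣ e ∣ ⟨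
  ℚ.∣ e ∣ ℚ.* 1ℚ        ≤⟨ ℚ.*-monoˡ-≤-nonNeg ℚ.∣ e ∣ {{ℚ.∣-∣-nonNeg e}}
                              (toℚ-mono-≤ {+ 1} {+ suc d} (+≤+ (ℕ.s≤s ℕ.z≤n))) ⟩
  ℚ.∣ e ∣ ℚ.* D         ≡⟨ cong (ℚ.∣ e ∣ ℚ.*_) (toℚ-homo-∣-∣ (+ suc d)) ⟩
  ℚ.∣ e ∣ ℚ.* ℚ.∣ D ∣   ≡⟨ ℚ.∣p*q∣≡∣p∣*∣q∣ e D ⟨
  ℚ.∣ e ℚ.* D ∣         ≡⟨ cong ℚ.∣_∣ ([y-Px/D]*D≡Dy-Px d y P x) ⟩
  ℚ.∣ toℚ z ∣           ≡⟨ toℚ-homo-∣-∣ z ⟨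
  toℚ (+ ∣ z ∣)         ≤⟨ toℚ-mono-≤ (+≤+ dist≤B) ⟩
  toℚ (+ B)             ∎
  where
  open ℚ.≤-Reasoning
  e = toℚ y ℚ.- linear (P ℚ./ suc d) 0ℚ x
  D = toℚ (+ suc d)
  z = + suc d * y - P * x

variable
  f g h : ℤ → ℤ
  P Q R : ℤ → Set

record Eventually (P : ℤ → Set) : Set where
  constructor eventually
  field
    threshold : ℕ
    holds     : ∀ n → threshold ℕ.≤ n → P (+ n)

eventually-map : (∀ n → P (+ n) → Q (+ n)) → Eventually P → Eventually Q
eventually-map f (eventually M p) = eventually M λ n M≤n → f n (p n M≤n)

eventually-zipWith : (∀ n → P (+ n) → Q (+ n) → R (+ n)) → Eventually P → Eventually Q → Eventually R
eventually-zipWith f (eventually M p) (eventually N q) = eventually (M ℕ.⊔ N) λ n M⊔N≤n →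
  f n (p n (ℕ.m⊔n≤o⇒m≤o M N M⊔N≤n)) (q n (ℕ.m⊔n≤o⇒n≤o M N M⊔N≤n))

eventually-≥ : (ev : Eventually P) → ∀ {x} → + Eventually.threshold ev ≤ x → P x
eventually-≥ (eventually M p) (+≤+ M≤n) = p _ M≤n

record EventuallyLinear (f : ℤ → ℤ) : Set where
  constructor eventuallyLinear
  field
    numerator     : ℤ
    denominator-1 : ℕ
    error         : ℕ
    near-line     : Eventually (λ x → Near (+ suc denominator-1) (f x) numerator x error)

eventuallyLinear-resp : (∀ x → f x ≡ g x) → EventuallyLinear f → EventuallyLinear g
eventuallyLinear-resp f≡g (eventuallyLinear P d B ev) =
  eventuallyLinear P d B (eventually-map (λ n → subst (λ y → Near _ y P (+ n) B) (f≡g (+ n))) ev)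

eventuallyLinear-const : ∀ c → EventuallyLinear (λ _ → c)
eventuallyLinear-const c =
  eventuallyLinear (+ 0) 0 ∣ c ∣ (eventually 0 λ n _ → near-exact c (line c (+ n)))
  where
  line : ∀ c x → + 1 * c - + 0 * x ≡ c
  line = solve-∀

eventuallyLinear-id : EventuallyLinear (λ x → x)
eventuallyLinear-id = eventuallyLinear (+ 1) 0 0 (eventually 0 λ n _ → near-exact (+ 0) (line (+ n)))
  where
  line : ∀ x → + 1 * x - + 1 * x ≡ + 0
  line = solve-∀

eventuallyLinear-* : ∀ a → EventuallyLinear f → EventuallyLinear (λ x → a * f x)
eventuallyLinear-* a (eventuallyLinear P d B ev) =
  eventuallyLinear (a * P) d (∣ a ∣ ℕ.* B) (eventually-map (λ _ → near-* a) ev)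

eventuallyLinear-neg : EventuallyLinear f → EventuallyLinear (λ x → - f x)
eventuallyLinear-neg {f} r = eventuallyLinear-resp (λ x → ℤ.-1*i≡-i (f x)) (eventuallyLinear-* ℤ.-1ℤ r)

-- Denominators are stored as predecessors: (d₁ + 1)(d₂ + 1) = 1 + (d₂ + d₁ (d₂ + 1)).
eventuallyLinear-+ : EventuallyLinear f → EventuallyLinear g → EventuallyLinear (λ x → f x + g x)
eventuallyLinear-+ (eventuallyLinear P₁ d₁ B₁ ev₁) (eventuallyLinear P₂ d₂ B₂ ev₂) =
  eventuallyLinear (+ suc d₂ * P₁ + + suc d₁ * P₂) (d₂ ℕ.+ d₁ ℕ.* suc d₂) (suc d₂ ℕ.* B₁ ℕ.+ suc d₁ ℕ.* B₂)
    (eventually-zipWith (λ _ n₁ n₂ → near-+ (near-scaleʳ (+ suc d₂) n₁) (near-scaleˡ (+ suc d₁) n₂)) ev₁ ev₂)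

eventuallyLinear-⊔ : EventuallyLinear f → EventuallyLinear g → EventuallyLinear (λ x → f x ⊔ g x)
eventuallyLinear-⊔ (eventuallyLinear P₁ d₁ B₁ ev₁) (eventuallyLinear P₂ d₂ B₂ ev₂) =
  eventuallyLinear (+ suc d₂ * P₁ ⊔ + suc d₁ * P₂) (d₂ ℕ.+ d₁ ℕ.* suc d₂) (suc d₂ ℕ.* B₁ ℕ.⊔ suc d₁ ℕ.* B₂)
    (eventually-zipWith (λ _ n₁ n₂ → near-⊔ (near-scaleʳ (+ suc d₂) n₁) (near-scaleˡ (+ suc d₁) n₂)) ev₁ ev₂)

eventuallyLinear-div-suc : ∀ m → EventuallyLinear f → EventuallyLinear (λ x → divFloor (+ suc m) (f x))
eventuallyLinear-div-suc {f} m (eventuallyLinear P d B ev) =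
  eventuallyLinear P (m ℕ.+ d ℕ.* suc m) (B ℕ.+ suc d ℕ.* suc m)
    (eventually-map (λ n near-f → near-quotient near-f (∣i-⌊i/n⌋*n∣≤n (f (+ n)) (suc m))) ev)

eventuallyLinear-div : ∀ m → m ≢ + 0 → EventuallyLinear f → EventuallyLinear (λ x → divFloor m (f x))
eventuallyLinear-div (+ zero)  m≢0 _ = contradiction refl m≢0
eventuallyLinear-div (+ suc m) _   r = eventuallyLinear-div-suc m r
eventuallyLinear-div -[1+ m ]  _   r = eventuallyLinear-div-suc m (eventuallyLinear-neg r)

eventuallyLinear-sum : ∀ n {F : Fin n → ℤ → ℤ} → (∀ i → EventuallyLinear (F i)) →
                       EventuallyLinear (λ x → sumℤ n (λ i → F i x))
eventuallyLinear-sum zero    _ = eventuallyLinear-const (+ 0)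
eventuallyLinear-sum (suc n) r = eventuallyLinear-+ (r zero) (eventuallyLinear-sum n (λ i → r (suc i)))

eventuallyLinear-eval : ∀ C → EventuallyLinear h → EventuallyLinear (λ x → eval C (h x))
eventuallyLinear-eval input            r = r
eventuallyLinear-eval (affine n c a C) r = eventuallyLinear-+ (eventuallyLinear-const c)
  (eventuallyLinear-sum n (λ i → eventuallyLinear-* (a i) (eventuallyLinear-eval (C i) r)))
eventuallyLinear-eval (maxG C₁ C₂)     r =
  eventuallyLinear-⊔ (eventuallyLinear-eval C₁ r) (eventuallyLinear-eval C₂ r)
eventuallyLinear-eval (divG m m≢0 C)   r = eventuallyLinear-div m m≢0 (eventuallyLinear-eval C r)

eventuallyLinear⇒pseudoLinear : EventuallyLinear (λ x → f (- x)) → EventuallyLinear f →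
                                PseudoLinear (λ x → toℚ (f x))
eventuallyLinear⇒pseudoLinear {f} (eventuallyLinear P₁ d₁ B₁ ev₁) (eventuallyLinear P₂ d₂ B₂ ev₂) =
  toℚ (+ M) , toℚ (+ B) , toℚ-mono-≤ {+ 0} {+ M} (+≤+ ℕ.z≤n) , toℚ-mono-≤ {+ 0} {+ B} (+≤+ ℕ.z≤n) ,
  (- P₁) ℚ./ suc d₁ , 0ℚ , P₂ ℚ./ suc d₂ , 0ℚ , left-tail , right-tail
  where
  open Eventually
  M₁ = threshold ev₁
  M₂ = threshold ev₂
  M = M₁ ℕ.⊔ M₂
  B = B₁ ℕ.⊔ B₂
  within-B : ∀ {d y P x B′} → B′ ℕ.≤ B → Near (+ suc d) y P x B′ →
             ℚ.∣ toℚ y ℚ.- linear (P ℚ./ suc d) 0ℚ x ∣ ℚ.≤ toℚ (+ B)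
  within-B B′≤B near-y = ℚ.≤-trans (near⇒∣y-Px/D∣≤B near-y) (toℚ-mono-≤ (+≤+ B′≤B))
  right-tail : ∀ x → toℚ (+ M) ℚ.≤ toℚ x →
               ℚ.∣ toℚ (f x) ℚ.- linear (P₂ ℚ./ suc d₂) 0ℚ x ∣ ℚ.≤ toℚ (+ B)
  right-tail x M≤x = within-B (ℕ.m≤n⊔m B₁ B₂)
    (eventually-≥ ev₂ (ℤ.≤-trans (+≤+ (ℕ.m≤n⊔m M₁ M₂)) (toℚ-cancel-≤ M≤x)))
  left-tail : ∀ x → toℚ x ℚ.≤ ℚ.- toℚ (+ M) →
              ℚ.∣ toℚ (f x) ℚ.- linear ((- P₁) ℚ./ suc d₁) 0ℚ x ∣ ℚ.≤ toℚ (+ B)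
  left-tail x x≤-M = within-B (ℕ.m≤m⊔n B₁ B₂)
    (near-flip (subst (λ y → Near _ y P₁ (- x) B₁) (cong f (ℤ.neg-involutive x)) (eventually-≥ ev₁ M₁≤-x)))
    where
    M≤-x : + M ≤ - x
    M≤-x = subst (_≤ - x) (ℤ.neg-involutive (+ M))
             (ℤ.neg-mono-≤ (toℚ-cancel-≤ (subst (toℚ x ℚ.≤_) (sym (toℚ-homo‿- (+ M))) x≤-M)))
    M₁≤-x : + M₁ ≤ - x
    M₁≤-x = ℤ.≤-trans (+≤+ (ℕ.m≤m⊔n M₁ M₂)) M≤-x

mainTheorem10 : (f : ℤ → ℤ) → InMaxDivClosure f → PseudoLinear (λ x → toℚ (f x))
mainTheorem10 f (C , C≡f) = eventuallyLinear⇒pseudoLinear at-−∞ at-+∞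
  where
  at-+∞ : EventuallyLinear f
  at-+∞ = eventuallyLinear-resp C≡f (eventuallyLinear-eval C eventuallyLinear-id)
  at-−∞ : EventuallyLinear (λ x → f (- x))
  at-−∞ = eventuallyLinear-resp (λ x → C≡f (- x))
            (eventuallyLinear-eval C (eventuallyLinear-neg eventuallyLinear-id))
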